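{- Let $S$ be a proper diagram. Then there exist $t\ge 0$ and a sequence of strict swaps $\epsilon_1,\dots,\epsilon_t$ such that $\epsilon_t\epsilon_{t-1}\cdots\epsilon_1(S)$ is a regular diagram equivalent to $S$.
   Context: A diagram of length $n$ is a simple graph on sites $\{1,\dots,n\}$ whose edges (arcs) are pairs $(s_1,s_2)$ with $s_1<s_2$ and $1<s_2-s_1<n-1$, supported by $s_1,s_2$. A diagram is binary if it has at least one arc and each site supports at most one arc. A site is free if it supports no arc; $s$ is covered by $(s_1,s_2)$ if $s_1<s<s_2$. Arcs $(s_1,s_2),(s_1',s_2')$ cross if $s_1<s_1'<s_2<s_2'$ or $s_1'<s_1<s_2'<s_2$; the number of crossings of a diagram is the number of pairs of crossing arcs. A diagram is proper if it is binary, each arc covers at least one free site, and no arc covers all free sites. If $u_1<\dots<u_f$ are the free sites, $u_0=0$, $u_{f+1}=n+1$, the $i$-th block is the set of sites $s$ with $u_{i-1}<s<u_i$. A diagram is regular if it is binary and no two crossing arcs have supporting sites lying in a common block. Swap: if $s_1$ and $s_2=s_1+1$ are non-free sites of a proper diagram $S$ and $r_i$ is the site base-paired with $s_i$ ($i=1,2$), the swap $\epsilon=\epsilon[s_1]$ produces the diagram $\epsilon(S)$ obtained by replacing the arcs $\{s_1,r_1\}$ and $\{s_2,r_2\}$ with the arcs $\{s_1,r_2\}$ and $\{s_2,r_1\}$. A swap is strict if $\epsilon(S)$ has one fewer crossing than $S$. Two proper diagrams $S,S'$ are equivalent if they have the same length and there is a bijection $\phi$ from the arcs of $S$ to those of $S'$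 such that for each arc $e$ and each free site $s$ of $S$, $s$ is covered by $e$ iff $s$ is covered by $\phi(e)$ in $S'$. -}

module Defs where

open import Data.Nat using (ℕ; suc; _≤_; _<_; _∸_; _<ᵇ_)
open import Data.Nat.Properties using (_≟_)
open import Data.Bool using (Bool; true; false; _∧_; if_then_else_)
open import Data.Product using (Σ; ∃; ∃-syntax; _×_; _,_; proj₁; proj₂)
open import Data.Product.Properties using (≡-dec)
open import Data.Sum using (_⊎_)
open import Data.Empty using (⊥)
open import Data.List using (List; []; length; map; filter; concatMap; lookup)
open import Data.List.Membership.Propositional using (_∈_)
open import Data.List.Relation.Unary.All using (All)
open import Data.List.Relation.Unary.Unique.Propositional using (Unique)
open import Data.Fin using (Fin)
open import Relation.Nullary using (¬_; Dec; yes; no)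
open import Relation.Binary.PropositionalEquality using (_≡_; _≢_)
open import Function.Bundles using (Bijection; _⇔_)

-- An arc (s₁ , s₂) is always stored with s₁ < s₂.
Arc : Set
Arc = ℕ × ℕ

ValidArc : ℕ → Arc → Set
ValidArc n (a , b) = 1 ≤ a × a < b × b ≤ n × 1 < b ∸ a × b ∸ a < n ∸ 1

IsDiagram : ℕ → List Arc → Set
IsDiagram n A = All (ValidArc n) A × Unique A

Supports : Arc → ℕ → Set
Supports (a , b) s = a ≡ s ⊎ b ≡ s

Site : ℕ → ℕ → Set
Site n s = 1 ≤ s × s ≤ n

Supported : List Arc → ℕ → Set
Supported A s = ∃[ e ] (e ∈ A × Supports e s)

Free : ℕ → List Arc → ℕ → Set
Free n A s = Site n s × ¬ Supported A s

Binary : List Arc → Set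
Binary A = (A ≢ []) × (∀ e e' s → e ∈ A → e' ∈ A → Supports e s → Supports e' s → e ≡ e')

Covered : ℕ → Arc → Set
Covered s (a , b) = a < s × s < b

Proper : ℕ → List Arc → Set
Proper n A = IsDiagram n A × Binary A
  × (∀ e → e ∈ A → ∃[ s ] (Free n A s × Covered s e))
  × (∀ e → e ∈ A → ¬ (∀ s → Free n A s → Covered s e))

Cross : Arc → Arc → Set
Cross (a , b) (a' , b') = (a < a' × a' < b × b < b') ⊎ (a' < a × a < b' × b' < b)

-- s and s' lie in a common block: both are sites, neither is free, and no free
-- site lies between them (the block of a non-free site s is the maximal
-- interval of non-free sites around s bounded by free sites / 0 / n+1).
SameBlock : ℕ → List Arc → ℕ → ℕ → Set
SameBlock n A s s' = Site n s × Site n s' × ¬ Free n A s × ¬ Free n A s'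
  × (∀ u → Free n A u → ¬ ((s ≤ u × u ≤ s') ⊎ (s' ≤ u × u ≤ s)))

Regular : ℕ → List Arc → Set
Regular n A = IsDiagram n A × Binary A
  × (∀ e e' x y → e ∈ A → e' ∈ A → Cross e e' → Supports e x → Supports e' y
       → ¬ SameBlock n A x y)

-- Number of crossings: each unordered crossing pair {e,e'} is counted once,
-- via the ordered pair with the smaller left endpoint first.
crossesᵇ : Arc → Arc → Bool
crossesᵇ (a , b) (a' , b') = (a <ᵇ a') ∧ (a' <ᵇ b) ∧ (b <ᵇ b')

crossings : List Arc → ℕ
crossings A = length (filter (λ p → T? (crossesᵇ (proj₁ p) (proj₂ p)))
                             (concatMap (λ e → map (λ e' → (e , e')) A) A))
  where
  open import Data.Bool using (T)
  open import Data.Bool.Properties using (T?)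

Linked : List Arc → ℕ → ℕ → Set
Linked A s r = (s , r) ∈ A ⊎ (r , s) ∈ A

norm : ℕ → ℕ → Arc
norm x y = if x <ᵇ y then (x , y) else (y , x)

_≟ᵃ_ : (e e' : Arc) → Dec (e ≡ e')
_≟ᵃ_ = ≡-dec _≟_ _≟_

swapArc : ℕ → ℕ → ℕ → Arc → Arc
swapArc s₁ r₁ r₂ e with e ≟ᵃ norm s₁ r₁
... | yes _ = norm s₁ r₂
... | no _ with e ≟ᵃ norm (suc s₁) r₂
...   | yes _ = norm (suc s₁) r₁
...   | no _ = e

swapArcs : ℕ → ℕ → ℕ → List Arc → List Arc
swapArcs s₁ r₁ r₂ = map (swapArc s₁ r₁ r₂)

SwapStep : ℕ → List Arc → List Arc → Set
SwapStep n A B = Proper n A × ∃[ s₁ ] ∃[ r₁ ] ∃[ r₂ ]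
  ( Site n s₁ × Site n (suc s₁)
  × Supported A s₁ × Supported A (suc s₁)
  × Linked A s₁ r₁ × Linked A (suc s₁) r₂
  × B ≡ swapArcs s₁ r₁ r₂ A
  × IsDiagram n B )

StrictSwap : ℕ → List Arc → List Arc → Set
StrictSwap n A B = SwapStep n A B × suc (crossings B) ≡ crossings A

data StrictSwaps (n : ℕ) : List Arc → List Arc → Set where
  done : ∀ {A} → StrictSwaps n A A
  step : ∀ {A B C} → StrictSwap n A B → StrictSwaps n B C → StrictSwaps n A C

Equivalent : ℕ → List Arc → List Arc → Set
Equivalent n A B = Proper n A × Proper n B ×
  Σ (Bijection (≡-setoid (Fin (length A))) (≡-setoid (Fin (length B)))) λ φ →
    ∀ i s → Free n A s →
      (Covered s (lookup A i) ⇔ Covered s (lookup B (Bijection.to φ i)))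
  where open import Relation.Binary.PropositionalEquality using () renaming (setoid to ≡-setoid)

module Submission where

-- A swap at s exchanges the partners r₁, r₂ of the adjacent sites s and s + 1.
-- No free site lies between s and s + 1, so the new arc {s, r₂} covers the same
-- free sites as the old arc {s + 1, r₂}, and {s + 1, r₁} the same as {s, r₁}:
-- a swap always gives an equivalent proper diagram. For the same reason the
-- two new arcs meet every other arc exactly as the two old ones did, so when
-- the old arcs crossed the swap is strict. As each strict swap removes a
-- crossing, repeating them stops at a diagram in which no two crossing arcs are
-- based at adjacent sites. Such a diagram is regular: if crossing arcs were
-- based at x < y in one block, then the arc at x + 1 would cross the arc at x,
-- or cross the arc at y (and we continue from x + 1), or have both ends inside
-- the block; and an arc with both ends in a block leads in the same way to
-- crossing arcs at adjacent sites.

open import Defs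
open import Data.Bool using (true; false; T; if_then_else_; _∧_)
open import Data.Bool.Properties using (T-∧; T?)
open import Data.Fin using (Fin; zero; suc; cast) renaming (_≟_ to _≟ᶠ_)
import Data.Fin.Permutation.Components as PC
open import Data.Fin.Permutation using (Permutation; transpose; cast-id; _∘ₚ_)
open import Data.List using (List; []; _∷_; _++_; map; filter; length; concatMap; lookup)
open import Data.List.Properties using (filter-++; length-++; length-map; map-cong-local; map-id-local)
open import Data.List.Membership.Propositional using (_∈_; find; lose)
open import Data.List.Relation.Unary.All as All using (All; _∷_)
open import Data.List.Membership.Propositional.Properties using (∈-∃++; ∈-lookup)
open import Data.List.Relation.Unary.Any using (Any; here; there; index; any?)
open import Data.List.Relation.Unary.Any.Properties using (lookup-index)
open import Data.List.Relation.Unary.AllPairs using (_∷_)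
open import Data.List.Relation.Unary.Unique.Propositional using (Unique)
open import Data.List.Relation.Binary.Permutation.Propositional using (_↭_; ↭-sym; ↭-trans; ↭-prep; ↭⇒↭ₛ)
open import Data.List.Relation.Binary.Permutation.Propositional.Properties using (map⁺; shift; ∈-resp-↭)
open import Data.Nat using (ℕ; zero; suc; _+_; _≤_; _<_; _∸_; _<ᵇ_; s≤s; z<s; _<?_)
open import Data.Nat.ListAction using (sum)
open import Data.Nat.ListAction.Properties using (sum-↭)
open import Data.Nat.Properties
open import Algebra.Properties.CommutativeSemigroup +-commutativeSemigroup using (interchange)
open import Data.Nat.Tactic.RingSolver using (solve-∀)
open import Data.Product using (∃-syntax; _×_; _,_; proj₁; proj₂; map₁; map₂)
open import Data.Sum using (_⊎_; inj₁; inj₂; swap; [_,_]′)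
open import Data.Unit using (tt)
open import Function using (_∘_; id)
open import Function.Bundles using (_⇔_; mk⇔; Equivalence; Bijection)
open import Function.Construct.Composition using (_⤖-∘_; _⇔-∘_)
open import Function.Construct.Identity using (⇔-id; ⤖-id)
open import Function.Construct.Symmetry using (⇔-sym)
open import Function.Properties.Inverse using (↔⇒⤖)
open import Relation.Binary.Definitions using (tri<; tri≈; tri>)
open import Relation.Binary.PropositionalEquality
import Data.List.Relation.Binary.Permutation.Setoid.Properties (setoid Arc) as PermutationProperties
open import Relation.Nullary using (¬_; Dec; yes; no; contradiction)
open import Relation.Nullary.Decidable using (dec-true; dec-false; map′; _×-dec_; _⊎-dec_)
open import Relation.Nullary.Reflects using (ofʸ; ofⁿ)

private
  variable
    n a b a′ b′ i o p q s r r₁ r₂ t u u′ x y : ℕ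
    e e′ : Arc

extract : {xs : List Arc} → e ∈ xs → ∃[ ys ] (xs ↭ e ∷ ys)
extract e∈xs with ys , zs , refl ← ∈-∃++ e∈xs = ys ++ zs , shift _ ys zs

extract₂ : {xs : List Arc} → e ∈ xs → e′ ∈ xs → e ≢ e′ → ∃[ zs ] (xs ↭ e ∷ e′ ∷ zs)
extract₂ e∈xs e′∈xs e≢e′ with ys , xs↭ ← extract e∈xs with ∈-resp-↭ xs↭ e′∈xs
... | here e′≡e    = contradiction (sym e′≡e) e≢e′
... | there e′∈ys with zs , ys↭ ← extract e′∈ys = zs , ↭-trans xs↭ (↭-prep _ ys↭)

∈⇒≢[] : {xs : List Arc} → e ∈ xs → xs ≢ []
∈⇒≢[] () refl

Unique-resp-↭ : {xs ys : List Arc} → xs ↭ ys → Unique xs → Unique ys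
Unique-resp-↭ p = PermutationProperties.Unique-resp-↭ (↭⇒↭ₛ p)

lookup-injective : {xs : List Arc} → Unique xs → ∀ i j → lookup xs i ≡ lookup xs j → i ≡ j
lookup-injective (_ ∷ _)     zero    zero    _  = refl
lookup-injective (x∉ ∷ _)    zero    (suc j) eq = contradiction eq (All.lookup x∉ (∈-lookup j))
lookup-injective (x∉ ∷ _)    (suc i) zero    eq = contradiction (sym eq) (All.lookup x∉ (∈-lookup i))
lookup-injective (_ ∷ uniq)  (suc i) (suc j) eq = cong suc (lookup-injective uniq i j eq)

lookup-map : (f : Arc → Arc) (xs : List Arc) (i : Fin (length xs)) →
  lookup (map f xs) (cast (sym (length-map f xs)) i) ≡ f (lookup xs i)
lookup-map f (x ∷ xs) zero    = refl
lookup-map f (x ∷ xs) (suc i) = lookup-map f xs i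

transpose-ˡ : ∀ {m} (i j : Fin m) → PC.transpose i j i ≡ j
transpose-ˡ i j rewrite dec-true (i ≟ᶠ i) refl = refl

transpose-ʳ : ∀ {m} {i j : Fin m} → i ≢ j → PC.transpose i j j ≡ i
transpose-ʳ {i = i} {j} i≢j rewrite dec-false (j ≟ᶠ i) (≢-sym i≢j) | dec-true (j ≟ᶠ j) refl = refl

transpose-other : ∀ {m} {i j k : Fin m} → k ≢ i → k ≢ j → PC.transpose i j k ≡ k
transpose-other {i = i} {j} {k} k≢i k≢j rewrite dec-false (k ≟ᶠ i) k≢i | dec-false (k ≟ᶠ j) k≢j = refl

norm-< : x < y → norm x y ≡ (x , y)
norm-< {x} {y} x<y with x <ᵇ y | <ᵇ-reflects-< x y
... | true  | _       = refl
... | false | ofⁿ x≮y = contradiction x<y x≮y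

norm-> : y < x → norm x y ≡ (y , x)
norm-> {y} {x} y<x with x <ᵇ y | <ᵇ-reflects-< x y
... | false | _       = refl
... | true  | ofʸ x<y = contradiction x<y (<⇒≯ y<x)

norm-cases : ∀ x y → norm x y ≡ (x , y) ⊎ norm x y ≡ (y , x)
norm-cases x y with x <ᵇ y
... | true  = inj₁ refl
... | false = inj₂ refl

norm-comm : x ≢ y → norm x y ≡ norm y x
norm-comm {x} {y} x≢y with <-cmp x y
... | tri< x<y _ _ = trans (norm-< x<y) (sym (norm-> x<y))
... | tri≈ _ x≡y _ = contradiction x≡y x≢y
... | tri> _ _ y<x = trans (norm-> y<x) (sym (norm-< y<x))

norm-supportsˡ : ∀ x y → Supports (norm x y) x
norm-supportsˡ x y with norm-cases x y
... | inj₁ eq = subst (λ e → Supports e x) (sym eq) (inj₁ refl)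
... | inj₂ eq = subst (λ e → Supports e x) (sym eq) (inj₂ refl)

norm-supportsʳ : ∀ x y → Supports (norm x y) y
norm-supportsʳ x y with norm-cases x y
... | inj₁ eq = subst (λ e → Supports e y) (sym eq) (inj₂ refl)
... | inj₂ eq = subst (λ e → Supports e y) (sym eq) (inj₁ refl)

norm-supports⁻ : Supports (norm x y) t → x ≡ t ⊎ y ≡ t
norm-supports⁻ {x} {y} {t} x-y∋t with norm-cases x y
... | inj₁ eq = subst (λ e → Supports e t) eq x-y∋t
... | inj₂ eq = swap (subst (λ e → Supports e t) eq x-y∋t)

norm∈⇒Linked : ∀ {A} → norm x y ∈ A → Linked A x y
norm∈⇒Linked {x} {y} {A} xy∈A with norm-cases x y
... | inj₁ eq = inj₁ (subst (_∈ A) eq xy∈A)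
... | inj₂ eq = inj₂ (subst (_∈ A) eq xy∈A)

record ArcEnds (n x y : ℕ) : Set where
  field
    siteˡ    : Site n x
    siteʳ    : Site n y
    distinct : x ≢ y
    sucˡ≢    : suc x ≢ y
    sucʳ≢    : suc y ≢ x

ArcEnds-sym : ArcEnds n x y → ArcEnds n y x
ArcEnds-sym ends = record
  { siteˡ = siteʳ ; siteʳ = siteˡ ; distinct = ≢-sym distinct ; sucˡ≢ = sucʳ≢ ; sucʳ≢ = sucˡ≢ }
  where open ArcEnds ends

ArcEnds-far : ArcEnds n x y → suc y < x ⊎ suc x < y
ArcEnds-far {x = x} {y} ends with <-cmp x y
... | tri< x<y _ _ = inj₂ (≤∧≢⇒< x<y (ArcEnds.sucˡ≢ ends))
... | tri≈ _ x≡y _ = contradiction x≡y (ArcEnds.distinct ends)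
... | tri> _ _ y<x = inj₁ (≤∧≢⇒< y<x (ArcEnds.sucʳ≢ ends))

validArc⇒ends-< : x < y → ValidArc n (x , y) → ArcEnds n x y
validArc⇒ends-< {x} {y} x<y (1≤x , _ , y≤n , 1<y∸x , _) = record
  { siteˡ    = 1≤x , ≤-trans (<⇒≤ x<y) y≤n
  ; siteʳ    = ≤-trans 1≤x (<⇒≤ x<y) , y≤n
  ; distinct = <⇒≢ x<y
  ; sucˡ≢    = λ { refl → <-irrefl (sym (m+n∸n≡m 1 x)) 1<y∸x }
  ; sucʳ≢    = λ { refl → <-asym x<y (n<1+n y) }
  }

validArc⇒ends : ValidArc n (norm x y) → ArcEnds n x y
validArc⇒ends {n} {x} {y} valid with <-cmp x y
... | tri< x<y _ _ = validArc⇒ends-< x<y (subst (ValidArc n) (norm-< x<y) valid)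
... | tri> _ _ y<x = ArcEnds-sym (validArc⇒ends-< y<x (subst (ValidArc n) (norm-> y<x) valid))
... | tri≈ _ refl _ with norm-cases x x
...   | inj₁ eq = contradiction (proj₁ (proj₂ (subst (ValidArc n) eq valid))) (<-irrefl refl)
...   | inj₂ eq = contradiction (proj₁ (proj₂ (subst (ValidArc n) eq valid))) (<-irrefl refl)

partner : ValidArc n e → Supports e t → ∃[ r ] (e ≡ norm t r)
partner (_ , a<b , _) (inj₁ refl) = _ , sym (norm-< a<b)
partner (_ , a<b , _) (inj₂ refl) = _ , sym (norm-> a<b)

-- Counting crossings

LeftCross : Arc → Arc → Set
LeftCross (a , b) (a′ , b′) = a < a′ × a′ < b × b < b′

LeftCross-irrefl : ¬ LeftCross e e
LeftCross-irrefl (a<a , _) = <-irrefl refl a<a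

LeftCross-asym : LeftCross e e′ → ¬ LeftCross e′ e
LeftCross-asym (a<a′ , _) (a′<a , _) = <-asym a<a′ a′<a

crossesᵇ⇒LeftCross : ∀ e e′ → T (crossesᵇ e e′) → LeftCross e e′
crossesᵇ⇒LeftCross (a , b) (a′ , b′) t
  with t₁ , t₂₃ ← Equivalence.to T-∧ t
  with t₂ , t₃ ← Equivalence.to T-∧ t₂₃
  = <ᵇ⇒< a a′ t₁ , <ᵇ⇒< a′ b t₂ , <ᵇ⇒< b b′ t₃

LeftCross⇒crossesᵇ : ∀ e e′ → LeftCross e e′ → T (crossesᵇ e e′)
LeftCross⇒crossesᵇ _ _ (p , q , r) =
  Equivalence.from T-∧ (<⇒<ᵇ p , Equivalence.from T-∧ (<⇒<ᵇ q , <⇒<ᵇ r))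

crossCount : Arc → Arc → ℕ
crossCount e e′ = if crossesᵇ e e′ then 1 else 0

crossCount-≡1 : LeftCross e e′ → crossCount e e′ ≡ 1
crossCount-≡1 {e} {e′} l with crossesᵇ e e′ | LeftCross⇒crossesᵇ e e′ l
... | true | _ = refl

crossCount-≡0 : ¬ LeftCross e e′ → crossCount e e′ ≡ 0
crossCount-≡0 {e} {e′} ¬l with crossesᵇ e e′ in eq
... | false = refl
... | true  = contradiction (crossesᵇ⇒LeftCross e e′ (subst T (sym eq) tt)) ¬l

crossCount-diag : ∀ e → crossCount e e ≡ 0
crossCount-diag e = crossCount-≡0 (LeftCross-irrefl {e})

Cross-irrefl : ¬ Cross e e
Cross-irrefl {e} (inj₁ l) = LeftCross-irrefl {e} l
Cross-irrefl {e} (inj₂ l) = LeftCross-irrefl {e} l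

Cross-sym : Cross e e′ → Cross e′ e
Cross-sym = swap

crossPair-cross : Cross e e′ → crossCount e e′ + crossCount e′ e ≡ 1
crossPair-cross (inj₁ l) = cong₂ _+_ (crossCount-≡1 l) (crossCount-≡0 (LeftCross-asym l))
crossPair-cross (inj₂ l) = cong₂ _+_ (crossCount-≡0 (LeftCross-asym l)) (crossCount-≡1 l)

crossPair-¬cross : ¬ Cross e e′ → crossCount e e′ + crossCount e′ e ≡ 0
crossPair-¬cross ¬c = cong₂ _+_ (crossCount-≡0 (¬c ∘ inj₁)) (crossCount-≡0 (¬c ∘ inj₂))

∑ : {X : Set} → List X → (X → ℕ) → ℕ
∑ xs f = sum (map f xs)

∑-↭ : {X : Set} {xs ys : List X} (f : X → ℕ) → xs ↭ ys → ∑ xs f ≡ ∑ ys f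
∑-↭ f p = sum-↭ (map⁺ f p)

∑-cong : {X : Set} (xs : List X) {f g : X → ℕ} → (∀ {x} → x ∈ xs → f x ≡ g x) → ∑ xs f ≡ ∑ xs g
∑-cong xs f≡g = cong sum (map-cong-local (All.tabulate f≡g))

∑-+ : {X : Set} (xs : List X) (f g : X → ℕ) → ∑ xs (λ x → f x + g x) ≡ ∑ xs f + ∑ xs g
∑-+ []       f g = refl
∑-+ (x ∷ xs) f g = trans (cong (f x + g x +_) (∑-+ xs f g)) (interchange (f x) (g x) _ _)

∑∑ : List Arc → (Arc → Arc → ℕ) → ℕ
∑∑ xs g = ∑ xs (λ x → ∑ xs (g x))

∑∑-↭ : ∀ {xs ys} g → xs ↭ ys → ∑∑ xs g ≡ ∑∑ ys g
∑∑-↭ {xs} {ys} g p = trans (∑-cong xs (λ _ → ∑-↭ (g _) p)) (∑-↭ (λ x → ∑ ys (g x)) p)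

crossings≡∑∑ : ∀ A → crossings A ≡ ∑∑ A crossCount
crossings≡∑∑ A = rows A
  where
  crosses? : (p : Arc × Arc) → Dec (T (crossesᵇ (proj₁ p) (proj₂ p)))
  crosses? (e , e′) = T? (crossesᵇ e e′)
  pairsWith : Arc → List (Arc × Arc)
  pairsWith e = map (e ,_) A
  row : ∀ e M → length (filter crosses? (map (e ,_) M)) ≡ ∑ M (crossCount e)
  row e [] = refl
  row e (e′ ∷ M) with crossesᵇ e e′
  ... | true  = cong suc (row e M)
  ... | false = row e M
  rows : ∀ L → length (filter crosses? (concatMap pairsWith L)) ≡ ∑ L (λ e → ∑ A (crossCount e))
  rows [] = refl
  rows (e ∷ L) = begin
    length (filter crosses? (pairsWith e ++ concatMap pairsWith L))
      ≡⟨ cong length (filter-++ crosses? (pairsWith e) _) ⟩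
    length (filter crosses? (pairsWith e) ++ filter crosses? (concatMap pairsWith L))
      ≡⟨ length-++ (filter crosses? (pairsWith e)) ⟩
    _ ≡⟨ cong₂ _+_ (row e A) (rows L) ⟩
    _ ∎
    where open ≡-Reasoning

∑∑-∷∷ : ∀ a b R g → ∑∑ (a ∷ b ∷ R) g ≡
  (g a a + g b b) + (g a b + g b a) + ∑ R (λ y → (g a y + g y a) + (g b y + g y b)) + ∑∑ R g
∑∑-∷∷ a b R g = begin
  ∑∑ (a ∷ b ∷ R) g
    ≡⟨ cong (λ z → g a a + (g a b + A₁) + (g b a + (g b b + B₁) + z)) columns ⟩
  g a a + (g a b + A₁) + (g b a + (g b b + B₁) + (A₂ + (B₂ + ∑∑ R g)))
    ≡⟨ rearrange (g a a) (g a b) A₁ (g b a) (g b b) B₁ A₂ B₂ (∑∑ R g) ⟩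
  (g a a + g b b) + (g a b + g b a) + ((A₁ + A₂) + (B₁ + B₂)) + ∑∑ R g
    ≡⟨ cong (λ z → (g a a + g b b) + (g a b + g b a) + z + ∑∑ R g) rows ⟨
  (g a a + g b b) + (g a b + g b a) + ∑ R (λ y → (g a y + g y a) + (g b y + g y b)) + ∑∑ R g ∎
  where
  open ≡-Reasoning
  A₁ A₂ B₁ B₂ : ℕ
  A₁ = ∑ R (g a)
  A₂ = ∑ R (λ y → g y a)
  B₁ = ∑ R (g b)
  B₂ = ∑ R (λ y → g y b)
  columns : ∑ R (λ y → g y a + (g y b + ∑ R (g y))) ≡ A₂ + (B₂ + ∑∑ R g)
  columns = trans (∑-+ R _ _) (cong (A₂ +_) (∑-+ R _ _))
  rows : ∑ R (λ y → (g a y + g y a) + (g b y + g y b)) ≡ (A₁ + A₂) + (B₁ + B₂)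
  rows = trans (∑-+ R _ _) (cong₂ _+_ (∑-+ R _ _) (∑-+ R _ _))
  rearrange : ∀ aa ab A₁ ba bb B₁ A₂ B₂ C →
    aa + (ab + A₁) + (ba + (bb + B₁) + (A₂ + (B₂ + C))) ≡ (aa + bb) + (ab + ba) + ((A₁ + A₂) + (B₁ + B₂)) + C
  rearrange = solve-∀

-- Swapping the partners of crossing arcs based at adjacent sites

Away : ℕ → ℕ → Set
Away s t = t ≢ s × t ≢ suc s

<ᵇ-cong : (x < y ⇔ a < b) → (x <ᵇ y) ≡ (a <ᵇ b)
<ᵇ-cong {x} {y} {a} {b} x<y⇔a<b
  with x <ᵇ y | <ᵇ-reflects-< x y | a <ᵇ b | <ᵇ-reflects-< a b
... | true  | _        | true  | _        = refl
... | false | _        | false | _        = refl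
... | true  | ofʸ x<y  | false | ofⁿ a≮b = contradiction (Equivalence.to x<y⇔a<b x<y) a≮b
... | false | ofⁿ x≮y  | true  | ofʸ a<b = contradiction (Equivalence.from x<y⇔a<b a<b) x≮y

<-shiftʳ : t ≢ suc s → s < t ⇔ suc s < t
<-shiftʳ t≢1+s = mk⇔ (λ s<t → ≤∧≢⇒< s<t (≢-sym t≢1+s)) (<-trans (n<1+n _))

<-shiftˡ : t ≢ s → t < s ⇔ t < suc s
<-shiftˡ t≢s = mk⇔ m<n⇒m<1+n (λ t<1+s → ≤∧≢⇒< (≤-pred t<1+s) t≢s)

SideOf : ℕ → ℕ → Set
SideOf s r = (r < s × norm s r ≡ (r , s) × norm (suc s) r ≡ (r , suc s))
           ⊎ (suc s < r × norm s r ≡ (s , r) × norm (suc s) r ≡ (suc s , r))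

sideOf : Away s r → SideOf s r
sideOf {s} {r} (r≢s , r≢1+s) with <-cmp r s
... | tri< r<s _ _ = inj₁ (r<s , norm-> r<s , norm-> (m<n⇒m<1+n r<s))
... | tri≈ _ r≡s _ = contradiction r≡s r≢s
... | tri> _ _ s<r = let 1+s<r = ≤∧≢⇒< s<r (≢-sym r≢1+s) in inj₂ (1+s<r , norm-< s<r , norm-< 1+s<r)

crossCount-shiftˡ : Away s r → Away s a → Away s b →
  crossCount (norm s r) (a , b) ≡ crossCount (norm (suc s) r) (a , b)
crossCount-shiftˡ {s} {r} {a} {b} away-r (a≢s , a≢1+s) (_ , b≢1+s) with sideOf away-r
... | inj₁ (_ , eq , eq′) rewrite eq | eq′ =
  cong₂ (λ u v → if (r <ᵇ a) ∧ u ∧ v then 1 else 0) (<ᵇ-cong (<-shiftˡ a≢s)) (<ᵇ-cong (<-shiftʳ b≢1+s))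
... | inj₂ (_ , eq , eq′) rewrite eq | eq′ =
  cong (λ u → if u ∧ (a <ᵇ r) ∧ (r <ᵇ b) then 1 else 0) (<ᵇ-cong (<-shiftʳ a≢1+s))

crossCount-shiftʳ : Away s r → Away s a → Away s b →
  crossCount (a , b) (norm s r) ≡ crossCount (a , b) (norm (suc s) r)
crossCount-shiftʳ {s} {r} {a} {b} away-r (a≢s , _) (b≢s , b≢1+s) with sideOf away-r
... | inj₁ (_ , eq , eq′) rewrite eq | eq′ =
  cong (λ u → if (a <ᵇ r) ∧ (r <ᵇ b) ∧ u then 1 else 0) (<ᵇ-cong (<-shiftˡ b≢s))
... | inj₂ (_ , eq , eq′) rewrite eq | eq′ =
  cong₂ (λ u v → if u ∧ v ∧ (b <ᵇ r) then 1 else 0) (<ᵇ-cong (<-shiftˡ a≢s)) (<ᵇ-cong (<-shiftʳ b≢1+s))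

crossPair-shift : Away s r → Away s a → Away s b →
  crossCount (norm s r) (a , b) + crossCount (a , b) (norm s r)
    ≡ crossCount (norm (suc s) r) (a , b) + crossCount (a , b) (norm (suc s) r)
crossPair-shift away-r away-a away-b =
  cong₂ _+_ (crossCount-shiftˡ away-r away-a away-b) (crossCount-shiftʳ away-r away-a away-b)

covered-shift : Away s r → Away s t → Covered t (norm s r) ⇔ Covered t (norm (suc s) r)
covered-shift {s} {r} {t} away-r (t≢s , t≢1+s) with sideOf away-r
... | inj₁ (_ , eq , eq′) rewrite eq | eq′ =
  mk⇔ (map₂ (Equivalence.to (<-shiftˡ t≢s))) (map₂ (Equivalence.from (<-shiftˡ t≢s)))
... | inj₂ (_ , eq , eq′) rewrite eq | eq′ =
  mk⇔ (map₁ (Equivalence.to (<-shiftʳ t≢1+s))) (map₁ (Equivalence.from (<-shiftʳ t≢1+s)))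

swap-uncrosses : Away s r₁ → Away s r₂ →
  Cross (norm s r₁) (norm (suc s) r₂) → ¬ Cross (norm s r₂) (norm (suc s) r₁)
swap-uncrosses {s} {r₁} {r₂} away₁ away₂ X Y with sideOf away₁ | sideOf away₂
... | inj₁ (_ , p₁ , q₁) | inj₁ (_ , p₂ , q₂) = go (subst₂ Cross p₁ q₂ X) (subst₂ Cross p₂ q₁ Y)
  where go : Cross (r₁ , s) (r₂ , suc s) → ¬ Cross (r₂ , s) (r₁ , suc s)
        go (inj₁ (u , _)) (inj₁ (v , _)) = <-asym u v
        go (inj₁ _) (inj₂ (_ , _ , w)) = 1+n≰n (<⇒≤ w)
        go (inj₂ (_ , _ , w)) _ = 1+n≰n (<⇒≤ w)
... | inj₁ (r₁<s , p₁ , _) | inj₂ (_ , _ , q₂) = go (subst₂ Cross p₁ q₂ X)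
  where go : ¬ Cross (r₁ , s) (suc s , r₂)
        go (inj₁ (_ , w , _)) = 1+n≰n (<⇒≤ w)
        go (inj₂ (w , _ , _)) = <-asym r₁<s (<-trans (n<1+n s) w)
... | inj₂ (_ , _ , q₁) | inj₁ (r₂<s , p₂ , _) = go (subst₂ Cross p₂ q₁ Y)
  where go : ¬ Cross (r₂ , s) (suc s , r₁)
        go (inj₁ (_ , w , _)) = 1+n≰n (<⇒≤ w)
        go (inj₂ (w , _ , _)) = <-asym r₂<s (<-trans (n<1+n s) w)
... | inj₂ (_ , p₁ , q₁) | inj₂ (_ , p₂ , q₂) = go (subst₂ Cross p₁ q₂ X) (subst₂ Cross p₂ q₁ Y)
  where go : Cross (s , r₁) (suc s , r₂) → ¬ Cross (s , r₂) (suc s , r₁)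
        go (inj₁ (_ , _ , u)) (inj₁ (_ , _ , v)) = <-asym u v
        go (inj₁ _) (inj₂ (w , _)) = 1+n≰n (<⇒≤ w)
        go (inj₂ (w , _)) _ = 1+n≰n (<⇒≤ w)

SameCover : ℕ → List Arc → Arc → Arc → Set
SameCover n A e e′ = ∀ u → Free n A u → Covered u e ⇔ Covered u e′

2+≤⇒1<∸ : suc (suc a) ≤ b → 1 < b ∸ a
2+≤⇒1<∸ {a} {b} 2+a≤b = subst (_≤ b ∸ a) (m+n∸n≡m 2 a) (∸-monoˡ-≤ a 2+a≤b)

∸<∸1 : 1 ≤ a → a < b → b ≤ n → (a ≡ 1 → b ≢ n) → b ∸ a < n ∸ 1
∸<∸1 {suc zero}    {suc b} {suc n} _ _           (s≤s b≤n) ¬ends = ≤∧≢⇒< b≤n (λ b≡n → ¬ends refl (cong suc b≡n))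
∸<∸1 {suc (suc a)} {suc b} {suc n} _ (s≤s a<b)   (s≤s b≤n) _     =
  <-≤-trans (∸-monoʳ-< {o = 0} z<s (<⇒≤ a<b)) b≤n

validArc-by-cover : ∀ {A} → Proper n A → x < y → Site n x → Site n y → Supported A x → Supported A y →
  e ∈ A → SameCover n A (x , y) e → ValidArc n (x , y)
validArc-by-cover {n} {x} {y} {e} {A} (_ , _ , covers , ¬coversAll) x<y (1≤x , _) (_ , y≤n) x-supp y-supp e∈A same =
  1≤x , x<y , y≤n , 2+≤⇒1<∸ 2+x≤y , ∸<∸1 1≤x x<y y≤n ends
  where
  2+x≤y : suc (suc x) ≤ y
  2+x≤y with u , u-free , e∋u ← covers e e∈A with x<u , u<y ← Equivalence.from (same u u-free) e∋u =
    ≤-trans (s≤s x<u) u<y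
  ends : x ≡ 1 → y ≢ n
  ends refl refl = ¬coversAll e e∈A λ u u-free@((1≤u , u≤n) , u-unsupp) →
    Equivalence.to (same u u-free)
      (≤∧≢⇒< 1≤u (λ { refl → u-unsupp x-supp }) , ≤∧≢⇒< u≤n (λ { refl → u-unsupp y-supp }))

proper-by-cover : ∀ {A B} → Proper n A → IsDiagram n B → Binary B → (∀ {u} → Free n A u → Free n B u) →
  (∀ {z} → z ∈ B → ∃[ e ] (e ∈ A × SameCover n A z e)) → Proper n B
proper-by-cover {n} {A} {B} (_ , _ , covers , ¬coversAll) diagram binary free⇒free twin =
  diagram , binary , coversB , ¬coversAllB
  where
  coversB : ∀ z → z ∈ B → ∃[ u ] (Free n B u × Covered u z)
  coversB z z∈B with e , e∈A , same ← twin z∈B with u , u-free , e∋u ← covers e e∈A =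
    u , free⇒free u-free , Equivalence.from (same u u-free) e∋u
  ¬coversAllB : ∀ z → z ∈ B → ¬ (∀ u → Free n B u → Covered u z)
  ¬coversAllB z z∈B all with e , e∈A , same ← twin z∈B =
    ¬coversAll e e∈A (λ u u-free → Equivalence.to (same u u-free) (all u (free⇒free u-free)))

validNorm-by-cover : ∀ {A} → Proper n A → x ≢ y → Site n x → Site n y → Supported A x → Supported A y →
  e ∈ A → SameCover n A (norm x y) e → ValidArc n (norm x y)
validNorm-by-cover {n} {x} {y} {e} {A} proper x≢y x-site y-site x-supp y-supp e∈A same with <-cmp x y
... | tri< x<y _ _ = subst (ValidArc n) (sym (norm-< x<y))
  (validArc-by-cover proper x<y x-site y-site x-supp y-supp e∈A (subst (λ z → SameCover n A z e) (norm-< x<y) same))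
... | tri≈ _ x≡y _ = contradiction x≡y x≢y
... | tri> _ _ y<x = subst (ValidArc n) (sym (norm-> y<x))
  (validArc-by-cover proper y<x y-site x-site y-supp x-supp e∈A (subst (λ z → SameCover n A z e) (norm-> y<x) same))

module Uncross {n A} (proper : Proper n A) {s r₁ r₂ : ℕ}
  (e₁∈A : norm s r₁ ∈ A) (e₂∈A : norm (suc s) r₂ ∈ A) (crossing : Cross (norm s r₁) (norm (suc s) r₂)) where

  e₁ e₂ e₁′ e₂′ : Arc
  e₁  = norm s r₁
  e₂  = norm (suc s) r₂
  e₁′ = norm s r₂
  e₂′ = norm (suc s) r₁

  swapped : Arc → Arc
  swapped = swapArc s r₁ r₂

  B : List Arc
  B = swapArcs s r₁ r₂ A

  valid : e ∈ A → ValidArc n e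
  valid = All.lookup (proj₁ (proj₁ proper))

  binary : e ∈ A → e′ ∈ A → Supports e t → Supports e′ t → e ≡ e′
  binary = proj₂ (proj₁ (proj₂ proper)) _ _ _

  ends₁ : ArcEnds n s r₁
  ends₁ = validArc⇒ends (valid e₁∈A)

  ends₂ : ArcEnds n (suc s) r₂
  ends₂ = validArc⇒ends (valid e₂∈A)

  e₁≢e₂ : e₁ ≢ e₂
  e₁≢e₂ e₁≡e₂ = Cross-irrefl (subst (Cross e₁) (sym e₁≡e₂) crossing)

  away₁ : Away s r₁
  away₁ = ≢-sym (ArcEnds.distinct ends₁) , ≢-sym (ArcEnds.sucˡ≢ ends₁)

  away₂ : Away s r₂
  away₂ = (λ r₂≡s → ArcEnds.sucʳ≢ ends₂ (cong suc r₂≡s)) , ≢-sym (ArcEnds.distinct ends₂)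

  r₁≢r₂ : r₁ ≢ r₂
  r₁≢r₂ refl = e₁≢e₂ (binary e₁∈A e₂∈A (norm-supportsʳ s r₁) (norm-supportsʳ (suc s) r₁))

  swapped-e₁ : swapped e₁ ≡ e₁′
  swapped-e₁ with e₁ ≟ᵃ e₁
  ... | yes _   = refl
  ... | no e₁≢e₁ = contradiction refl e₁≢e₁

  swapped-e₂ : swapped e₂ ≡ e₂′
  swapped-e₂ with e₂ ≟ᵃ e₁
  ... | yes e₂≡e₁ = contradiction (sym e₂≡e₁) e₁≢e₂
  ... | no _ with e₂ ≟ᵃ e₂
  ...   | yes _    = refl
  ...   | no e₂≢e₂ = contradiction refl e₂≢e₂

  swapped-other : e ≢ e₁ → e ≢ e₂ → swapped e ≡ e
  swapped-other {e} e≢e₁ e≢e₂ with e ≟ᵃ e₁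
  ... | yes e≡e₁ = contradiction e≡e₁ e≢e₁
  ... | no _ with e ≟ᵃ e₂
  ...   | yes e≡e₂ = contradiction e≡e₂ e≢e₂
  ...   | no _     = refl

  R : List Arc
  R = proj₁ (extract₂ e₁∈A e₂∈A e₁≢e₂)

  A↭ : A ↭ e₁ ∷ e₂ ∷ R
  A↭ = proj₂ (extract₂ e₁∈A e₂∈A e₁≢e₂)

  unique₁₂R : Unique (e₁ ∷ e₂ ∷ R)
  unique₁₂R = Unique-resp-↭ A↭ (proj₂ (proj₁ proper))

  R⊆A : e ∈ R → e ∈ A
  R⊆A e∈R = ∈-resp-↭ (↭-sym A↭) (there (there e∈R))

  R∌e₁ : e ∈ R → e ≢ e₁
  R∌e₁ e∈R with e₁∉ ∷ _ ← unique₁₂R = ≢-sym (All.lookup e₁∉ (there e∈R))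

  R∌e₂ : e ∈ R → e ≢ e₂
  R∌e₂ e∈R with _ ∷ e₂∉ ∷ _ ← unique₁₂R = ≢-sym (All.lookup e₂∉ e∈R)

  unique-R : Unique R
  unique-R with _ ∷ _ ∷ uniq ← unique₁₂R = uniq

  R-elsewhere : e ∈ R → Supports e t → Away s t × t ≢ r₁ × t ≢ r₂
  R-elsewhere {e} {t} e∈R e∋t =
    ( (λ { refl → R∌e₁ e∈R (binary (R⊆A e∈R) e₁∈A e∋t (norm-supportsˡ s r₁)) })
    , (λ { refl → R∌e₂ e∈R (binary (R⊆A e∈R) e₂∈A e∋t (norm-supportsˡ (suc s) r₂)) }) )
    , (λ { refl → R∌e₁ e∈R (binary (R⊆A e∈R) e₁∈A e∋t (norm-supportsʳ s r₁)) })
    , (λ { refl → R∌e₂ e∈R (binary (R⊆A e∈R) e₂∈A e∋t (norm-supportsʳ (suc s) r₂)) })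

  B↭ : B ↭ e₁′ ∷ e₂′ ∷ R
  B↭ = subst (B ↭_) (cong₂ _∷_ swapped-e₁ (cong₂ _∷_ swapped-e₂ R-fixed)) (map⁺ swapped A↭)
    where
    R-fixed : map swapped R ≡ R
    R-fixed = map-id-local (All.tabulate λ e∈R → swapped-other (R∌e₁ e∈R) (R∌e₂ e∈R))

  -- The crossings not involving e₁, e₂ are untouched, those of e₁ and e₂
  -- with the arcs of R are exchanged, and e₁′, e₂′ no longer cross.
  strict : suc (crossings B) ≡ crossings A
  strict = begin
    suc (crossings B)
      ≡⟨ cong suc (trans (crossings≡∑∑ B) (trans (∑∑-↭ crossCount B↭) (∑∑-∷∷ e₁′ e₂′ R crossCount))) ⟩
    suc ((χ e₁′ e₁′ + χ e₂′ e₂′) + (χ e₁′ e₂′ + χ e₂′ e₁′) + ∑ R pairs′ + ∑∑ R crossCount)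
      ≡⟨ drop-one (crossCount-diag e₁′) (crossCount-diag e₂′) (crossPair-¬cross uncrossed)
                  (crossCount-diag e₁) (crossCount-diag e₂) (crossPair-cross crossing) (∑-cong R exchanged) ⟩
    (χ e₁ e₁ + χ e₂ e₂) + (χ e₁ e₂ + χ e₂ e₁) + ∑ R pairs + ∑∑ R crossCount
      ≡⟨ sym (trans (crossings≡∑∑ A) (trans (∑∑-↭ crossCount A↭) (∑∑-∷∷ e₁ e₂ R crossCount))) ⟩
    crossings A ∎
    where
    open ≡-Reasoning
    χ = crossCount
    pairs pairs′ : Arc → ℕ
    pairs  y = (χ e₁ y + χ y e₁) + (χ e₂ y + χ y e₂)
    pairs′ y = (χ e₁′ y + χ y e₁′) + (χ e₂′ y + χ y e₂′)
    uncrossed : ¬ Cross e₁′ e₂′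
    uncrossed = swap-uncrosses away₁ away₂ crossing
    exchanged : ∀ {y} → y ∈ R → pairs′ y ≡ pairs y
    exchanged {a , b} y∈R =
      let away-a = proj₁ (R-elsewhere y∈R (inj₁ refl)) ; away-b = proj₁ (R-elsewhere y∈R (inj₂ refl)) in
      trans (cong₂ _+_ (crossPair-shift away₂ away-a away-b) (sym (crossPair-shift away₁ away-a away-b)))
            (+-comm (χ e₂ (a , b) + χ (a , b) e₂) (χ e₁ (a , b) + χ (a , b) e₁))
    drop-one : ∀ {d₁′ d₂′ p′ d₁ d₂ p q′ q t} → d₁′ ≡ 0 → d₂′ ≡ 0 → p′ ≡ 0 → d₁ ≡ 0 → d₂ ≡ 0 → p ≡ 1 → q′ ≡ q →
      suc ((d₁′ + d₂′) + p′ + q′ + t) ≡ (d₁ + d₂) + p + q + t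
    drop-one refl refl refl refl refl refl refl = refl

  in-B : e ∈ B → e ∈ e₁′ ∷ e₂′ ∷ R
  in-B = ∈-resp-↭ B↭

  e₁′∈B : e₁′ ∈ B
  e₁′∈B = ∈-resp-↭ (↭-sym B↭) (here refl)

  supported-in-A : Supported B t → Supported A t
  supported-in-A (e , e∈B , e∋t) with in-B e∈B
  ... | here refl with norm-supports⁻ {s} {r₂} e∋t
  ...   | inj₁ refl = e₁ , e₁∈A , norm-supportsˡ s r₁
  ...   | inj₂ refl = e₂ , e₂∈A , norm-supportsʳ (suc s) r₂
  supported-in-A (e , e∈B , e∋t) | there (here refl) with norm-supports⁻ {suc s} {r₁} e∋t
  ...   | inj₁ refl = e₂ , e₂∈A , norm-supportsˡ (suc s) r₂
  ...   | inj₂ refl = e₁ , e₁∈A , norm-supportsʳ s r₁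
  supported-in-A (e , e∈B , e∋t) | there (there e∈R) = e , R⊆A e∈R , e∋t

  free⇒free : Free n A t → Free n B t
  free⇒free (t-site , t-unsupp) = t-site , t-unsupp ∘ supported-in-A

  s-supported : Supported A s
  s-supported = e₁ , e₁∈A , norm-supportsˡ s r₁

  1+s-supported : Supported A (suc s)
  1+s-supported = e₂ , e₂∈A , norm-supportsˡ (suc s) r₂

  free-away : Free n A t → Away s t
  free-away (_ , t-unsupp) = (λ { refl → t-unsupp s-supported }) , (λ { refl → t-unsupp 1+s-supported })

  cover₁ : SameCover n A e₁′ e₂
  cover₁ u u-free = covered-shift away₂ (free-away u-free)

  cover₂ : SameCover n A e₂′ e₁
  cover₂ u u-free = ⇔-sym (covered-shift away₁ (free-away u-free))

  twin : e ∈ B → ∃[ e′ ] (e′ ∈ A × SameCover n A e e′)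
  twin e∈B with in-B e∈B
  ... | here refl         = e₂ , e₂∈A , cover₁
  ... | there (here refl) = e₁ , e₁∈A , cover₂
  ... | there (there e∈R) = _ , R⊆A e∈R , λ _ _ → ⇔-id _

  valid-B : All (ValidArc n) B
  valid-B = All.tabulate (valid′ ∘ in-B)
    where
    valid′ : e ∈ e₁′ ∷ e₂′ ∷ R → ValidArc n e
    valid′ (here refl) =
      validNorm-by-cover proper (≢-sym (proj₁ away₂)) (ArcEnds.siteˡ ends₁) (ArcEnds.siteʳ ends₂)
        s-supported (e₂ , e₂∈A , norm-supportsʳ (suc s) r₂) e₂∈A cover₁
    valid′ (there (here refl)) =
      validNorm-by-cover proper (≢-sym (proj₂ away₁)) (ArcEnds.siteˡ ends₂) (ArcEnds.siteʳ ends₁)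
        1+s-supported (e₁ , e₁∈A , norm-supportsʳ s r₁) e₁∈A cover₂
    valid′ (there (there e∈R)) = valid (R⊆A e∈R)

  e₁′-e₂′-disjoint : Supports e₁′ t → ¬ Supports e₂′ t
  e₁′-e₂′-disjoint e₁′∋t e₂′∋t with norm-supports⁻ {s} {r₂} e₁′∋t | norm-supports⁻ {suc s} {r₁} e₂′∋t
  ... | inj₁ refl | inj₁ 1+s≡s  = 1+n≢n 1+s≡s
  ... | inj₁ refl | inj₂ r₁≡s   = proj₁ away₁ r₁≡s
  ... | inj₂ refl | inj₁ 1+s≡r₂ = proj₂ away₂ (sym 1+s≡r₂)
  ... | inj₂ refl | inj₂ r₁≡r₂  = r₁≢r₂ r₁≡r₂

  R-e₁′-disjoint : e ∈ R → Supports e t → ¬ Supports e₁′ t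
  R-e₁′-disjoint e∈R e∋t e₁′∋t with R-elsewhere e∈R e∋t | norm-supports⁻ {s} {r₂} e₁′∋t
  ... | (t≢s , _) , _ | inj₁ s≡t  = t≢s (sym s≡t)
  ... | _ , _ , t≢r₂  | inj₂ r₂≡t = t≢r₂ (sym r₂≡t)

  R-e₂′-disjoint : e ∈ R → Supports e t → ¬ Supports e₂′ t
  R-e₂′-disjoint e∈R e∋t e₂′∋t with R-elsewhere e∈R e∋t | norm-supports⁻ {suc s} {r₁} e₂′∋t
  ... | (_ , t≢1+s) , _ | inj₁ 1+s≡t = t≢1+s (sym 1+s≡t)
  ... | _ , t≢r₁ , _    | inj₂ r₁≡t  = t≢r₁ (sym r₁≡t)

  unique-B : Unique B
  unique-B = Unique-resp-↭ (↭-sym B↭) ((e₁′≢e₂′ ∷ All.tabulate e₁′∉R) ∷ All.tabulate e₂′∉R ∷ unique-R)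
    where
    e₁′≢e₂′ : e₁′ ≢ e₂′
    e₁′≢e₂′ eq = e₁′-e₂′-disjoint (norm-supportsˡ s r₂) (subst (λ z → Supports z s) eq (norm-supportsˡ s r₂))
    e₁′∉R : e ∈ R → e₁′ ≢ e
    e₁′∉R e∈R refl = R-e₁′-disjoint e∈R (norm-supportsˡ s r₂) (norm-supportsˡ s r₂)
    e₂′∉R : e ∈ R → e₂′ ≢ e
    e₂′∉R e∈R refl = R-e₂′-disjoint e∈R (norm-supportsˡ (suc s) r₁) (norm-supportsˡ (suc s) r₁)

  binary-B : ∀ e e′ t → e ∈ B → e′ ∈ B → Supports e t → Supports e′ t → e ≡ e′
  binary-B _ _ _ e∈B e′∈B = share (in-B e∈B) (in-B e′∈B)
    where
    share : e ∈ e₁′ ∷ e₂′ ∷ R → e′ ∈ e₁′ ∷ e₂′ ∷ R → Supports e t → Supports e′ t → e ≡ e′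
    share (here refl)         (here refl)          _ _ = refl
    share (here refl)         (there (here refl))  p q = contradiction q (e₁′-e₂′-disjoint p)
    share (here refl)         (there (there e′∈R)) p q = contradiction p (R-e₁′-disjoint e′∈R q)
    share (there (here refl)) (here refl)          p q = contradiction p (e₁′-e₂′-disjoint q)
    share (there (here refl)) (there (here refl))  _ _ = refl
    share (there (here refl)) (there (there e′∈R)) p q = contradiction p (R-e₂′-disjoint e′∈R q)
    share (there (there e∈R)) (here refl)          p q = contradiction q (R-e₁′-disjoint e∈R p)
    share (there (there e∈R)) (there (here refl))  p q = contradiction q (R-e₂′-disjoint e∈R p)
    share (there (there e∈R)) (there (there e′∈R)) p q = binary (R⊆A e∈R) (R⊆A e′∈R) p q

  proper-B : Proper n B
  proper-B = proper-by-cover proper (valid-B , unique-B) (∈⇒≢[] e₁′∈B , binary-B) free⇒free twin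

  strictSwap : StrictSwap n A B
  strictSwap = ( proper , s , r₁ , r₂ , ArcEnds.siteˡ ends₁ , ArcEnds.siteˡ ends₂ , s-supported , 1+s-supported
               , norm∈⇒Linked e₁∈A , norm∈⇒Linked e₂∈A , refl , proj₁ proper-B )
             , strict

  i₁ i₂ : Fin (length A)
  i₁ = index e₁∈A
  i₂ = index e₂∈A

  lookup-i₁ : lookup A i₁ ≡ e₁
  lookup-i₁ = sym (lookup-index e₁∈A)

  lookup-i₂ : lookup A i₂ ≡ e₂
  lookup-i₂ = sym (lookup-index e₂∈A)

  i₁≢i₂ : i₁ ≢ i₂
  i₁≢i₂ i₁≡i₂ = e₁≢e₂ (trans (sym lookup-i₁) (trans (cong (lookup A) i₁≡i₂) lookup-i₂))

  index-of : ∀ k i → lookup A i ≡ e → lookup A k ≡ e → k ≡ i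
  index-of k i lookup-i lookup-k = lookup-injective (proj₂ (proj₁ proper)) k i (trans lookup-k (sym lookup-i))

  relabel : Permutation (length A) (length B)
  relabel = transpose i₁ i₂ ∘ₚ cast-id (sym (length-map swapped A))

  cover-at : ∀ k → SameCover n A (lookup A k) (swapped (lookup A (PC.transpose i₁ i₂ k)))
  cover-at k = by-cases k (k ≟ᶠ i₁) (k ≟ᶠ i₂)
    where
    by-cases : ∀ k → Dec (k ≡ i₁) → Dec (k ≡ i₂) →
      SameCover n A (lookup A k) (swapped (lookup A (PC.transpose i₁ i₂ k)))
    by-cases _ (yes refl) _
      rewrite transpose-ˡ i₁ i₂ | lookup-i₁ | lookup-i₂ | swapped-e₂ = λ u u-free → ⇔-sym (cover₂ u u-free)
    by-cases _ (no _) (yes refl)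
      rewrite transpose-ʳ i₁≢i₂ | lookup-i₁ | lookup-i₂ | swapped-e₁ = λ u u-free → ⇔-sym (cover₁ u u-free)
    by-cases k (no k≢i₁) (no k≢i₂)
      rewrite transpose-other k≢i₁ k≢i₂
            | swapped-other (k≢i₁ ∘ index-of k i₁ lookup-i₁) (k≢i₂ ∘ index-of k i₂ lookup-i₂) = λ _ _ → ⇔-id _

  equivalent : Equivalent n A B
  equivalent = proper , proper-B , ↔⇒⤖ relabel , λ k u u-free →
    subst (λ z → Covered u (lookup A k) ⇔ Covered u z) (sym (lookup-map swapped A (PC.transpose i₁ i₂ k)))
          (cover-at k u u-free)

-- Diagrams without adjacent crossings are regular

Outside : ℕ → ℕ → ℕ → Set
Outside x y o = o < x ⊎ y < o

-- The arcs joining sites i₁ < i₂ of [x, y] to o₁ and o₂ outside of it cross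
-- exactly when o₁ and o₂ are placed as follows; the inner ends do not matter.
OuterCross : ℕ → ℕ → ℕ → ℕ → Set
OuterCross x y o₁ o₂ = (y < o₁ × o₂ < x) ⊎ (o₁ < x × o₂ < x × o₁ < o₂) ⊎ (y < o₁ × y < o₂ × o₁ < o₂)

module _ {x y i₁ i₂ o₁ o₂ : ℕ} (x≤i₁ : x ≤ i₁) (i₁<i₂ : i₁ < i₂) (i₂≤y : i₂ ≤ y) where

  cross⇒outerCross : Outside x y o₁ → Outside x y o₂ → Cross (norm i₁ o₁) (norm i₂ o₂) → OuterCross x y o₁ o₂
  cross⇒outerCross (inj₁ o₁<x) (inj₁ o₂<x) X
    with subst₂ Cross (norm-> (<-≤-trans o₁<x x≤i₁)) (norm-> (<-≤-trans o₂<x (≤-trans x≤i₁ (<⇒≤ i₁<i₂)))) X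
  ... | inj₁ (o₁<o₂ , _ , _) = inj₂ (inj₁ (o₁<x , o₂<x , o₁<o₂))
  ... | inj₂ (_ , _ , i₂<i₁) = contradiction i₂<i₁ (<-asym i₁<i₂)
  cross⇒outerCross (inj₁ o₁<x) (inj₂ y<o₂) X
    with subst₂ Cross (norm-> (<-≤-trans o₁<x x≤i₁)) (norm-< (≤-<-trans i₂≤y y<o₂)) X
  ... | inj₁ (_ , i₂<i₁ , _) = contradiction i₂<i₁ (<-asym i₁<i₂)
  ... | inj₂ (i₂<o₁ , _ , _) =
    contradiction (<-trans i₂<o₁ (<-≤-trans o₁<x (≤-trans x≤i₁ (<⇒≤ i₁<i₂)))) (<-irrefl refl)
  cross⇒outerCross (inj₂ y<o₁) (inj₁ o₂<x) _ = inj₁ (y<o₁ , o₂<x)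
  cross⇒outerCross (inj₂ y<o₁) (inj₂ y<o₂) X
    with subst₂ Cross (norm-< (≤-<-trans (≤-trans (<⇒≤ i₁<i₂) i₂≤y) y<o₁)) (norm-< (≤-<-trans i₂≤y y<o₂)) X
  ... | inj₁ (_ , _ , o₁<o₂) = inj₂ (inj₂ (y<o₁ , y<o₂ , o₁<o₂))
  ... | inj₂ (i₂<i₁ , _ , _) = contradiction i₂<i₁ (<-asym i₁<i₂)

  outerCross⇒cross : OuterCross x y o₁ o₂ → Cross (norm i₁ o₁) (norm i₂ o₂)
  outerCross⇒cross (inj₁ (y<o₁ , o₂<x)) =
    subst₂ Cross (sym (norm-< (≤-<-trans (≤-trans (<⇒≤ i₁<i₂) i₂≤y) y<o₁)))
                 (sym (norm-> (<-≤-trans o₂<x (≤-trans x≤i₁ (<⇒≤ i₁<i₂)))))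
      (inj₂ (<-≤-trans o₂<x x≤i₁ , i₁<i₂ , ≤-<-trans i₂≤y y<o₁))
  outerCross⇒cross (inj₂ (inj₁ (o₁<x , o₂<x , o₁<o₂))) =
    subst₂ Cross (sym (norm-> (<-≤-trans o₁<x x≤i₁))) (sym (norm-> (<-≤-trans o₂<x (≤-trans x≤i₁ (<⇒≤ i₁<i₂)))))
      (inj₁ (o₁<o₂ , <-≤-trans o₂<x x≤i₁ , i₁<i₂))
  outerCross⇒cross (inj₂ (inj₂ (y<o₁ , y<o₂ , o₁<o₂))) =
    subst₂ Cross (sym (norm-< (≤-<-trans (≤-trans (<⇒≤ i₁<i₂) i₂≤y) y<o₁))) (sym (norm-< (≤-<-trans i₂≤y y<o₂)))
      (inj₁ (i₁<i₂ , ≤-<-trans i₂≤y y<o₁ , o₁<o₂))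

outerCross-split : ∀ {x y p q v} → Outside x y v → v ≢ p → OuterCross x y p q → OuterCross x y p v ⊎ OuterCross x y v q
outerCross-split (inj₁ v<x) _ (inj₁ (y<p , _))              = inj₁ (inj₁ (y<p , v<x))
outerCross-split (inj₂ y<v) _ (inj₁ (_ , q<x))              = inj₂ (inj₁ (y<v , q<x))
outerCross-split (inj₂ y<v) _ (inj₂ (inj₁ (_ , q<x , _)))   = inj₂ (inj₁ (y<v , q<x))
outerCross-split (inj₁ v<x) _ (inj₂ (inj₂ (y<p , _ , _)))   = inj₁ (inj₁ (y<p , v<x))
outerCross-split {p = p} {v = v} (inj₁ v<x) v≢p (inj₂ (inj₁ (p<x , q<x , p<q))) with <-cmp p v
... | tri< p<v _ _ = inj₁ (inj₂ (inj₁ (p<x , v<x , p<v)))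
... | tri≈ _ p≡v _ = contradiction (sym p≡v) v≢p
... | tri> _ _ v<p = inj₂ (inj₂ (inj₁ (v<x , q<x , <-trans v<p p<q)))
outerCross-split {p = p} {v = v} (inj₂ y<v) v≢p (inj₂ (inj₂ (y<p , y<q , p<q))) with <-cmp p v
... | tri< p<v _ _ = inj₁ (inj₂ (inj₂ (y<p , y<v , p<v)))
... | tri≈ _ p≡v _ = contradiction (sym p≡v) v≢p
... | tri> _ _ v<p = inj₂ (inj₂ (inj₂ (y<v , y<q , <-trans v<p p<q)))

AdjacentCrossing : List Arc → Set
AdjacentCrossing A = ∃[ e ] ∃[ e′ ] (e ∈ A × e′ ∈ A × Cross e e′ × ∃[ x ] (Supports e x × Supports e′ (suc x)))

supports? : ∀ e t → Dec (Supports e t)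
supports? (a , b) t = (a ≟ t) ⊎-dec (b ≟ t)

supported? : ∀ A t → Dec (Supported A t)
supported? A t = map′ find (λ (e , e∈A , e∋t) → lose e∈A e∋t) (any? (λ e → supports? e t) A)

cross? : ∀ e e′ → Dec (Cross e e′)
cross? (a , b) (a′ , b′) =
  ((a <? a′) ×-dec (a′ <? b) ×-dec (b <? b′)) ⊎-dec ((a′ <? a) ×-dec (a <? b′) ×-dec (b′ <? b))

adjacentCrossing? : ∀ A → Dec (AdjacentCrossing A)
adjacentCrossing? A = map′ to from (any? (λ e → any? (λ e′ → adjacent? e e′) A) A)
  where
  Adjacent : Arc → Arc → Set
  Adjacent e e′ = Cross e e′ × ∃[ x ] (Supports e x × Supports e′ (suc x))
  adjacent? : ∀ e e′ → Dec (Adjacent e e′)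
  adjacent? (a , b) e′ = cross? (a , b) e′ ×-dec
    map′ [ (λ e′∋1+a → a , inj₁ refl , e′∋1+a) , (λ e′∋1+b → b , inj₂ refl , e′∋1+b) ]′
         (λ { (_ , inj₁ refl , e′∋1+a) → inj₁ e′∋1+a ; (_ , inj₂ refl , e′∋1+b) → inj₂ e′∋1+b })
         (supports? e′ (suc a) ⊎-dec supports? e′ (suc b))
  to : Any (λ e → Any (Adjacent e) A) A → AdjacentCrossing A
  to any with e , e∈A , any′ ← find any with e′ , e′∈A , adj ← find any′ = e , e′ , e∈A , e′∈A , adj
  from : AdjacentCrossing A → Any (λ e → Any (Adjacent e) A) A
  from (e , e′ , e∈A , e′∈A , adj) = lose e∈A (lose e′∈A adj)

module Blocks {n A} (diagram : IsDiagram n A) (binary : Binary A) where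

  valid : e ∈ A → ValidArc n e
  valid = All.lookup (proj₁ diagram)

  ends : norm x y ∈ A → ArcEnds n x y
  ends xy∈A = validArc⇒ends (valid xy∈A)

  norm∈-comm : norm x y ∈ A → norm y x ∈ A
  norm∈-comm xy∈A = subst (_∈ A) (norm-comm (ArcEnds.distinct (ends xy∈A))) xy∈A

  partner-unique : norm t u ∈ A → norm t u′ ∈ A → u ≡ u′
  partner-unique {t} {u} {u′} tu∈A tu′∈A
    with norm-supports⁻ {t} {u′} (subst (λ e → Supports e u) (same-arc tu∈A tu′∈A) (norm-supportsʳ t u))
    where
    same-arc : norm t u ∈ A → norm t u′ ∈ A → norm t u ≡ norm t u′
    same-arc tu∈A tu′∈A = proj₂ binary _ _ t tu∈A tu′∈A (norm-supportsˡ t u) (norm-supportsˡ t u′)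
  ... | inj₁ t≡u  = contradiction t≡u (ArcEnds.distinct (ends tu∈A))
  ... | inj₂ u′≡u = sym u′≡u

  chord-at : Supported A t → ∃[ v ] (norm t v ∈ A)
  chord-at (e , e∈A , e∋t) with v , refl ← partner (valid e∈A) e∋t = v , e∈A

  adjacent-at : norm x p ∈ A → norm (suc x) q ∈ A → Cross (norm x p) (norm (suc x) q) → AdjacentCrossing A
  adjacent-at {x} {p} {q} xp∈A 1+xq∈A X = _ , _ , xp∈A , 1+xq∈A , X , x , norm-supportsˡ x p , norm-supportsˡ (suc x) q

  InBlock : ℕ → ℕ → Set
  InBlock x y = ∀ t → x ≤ t → t ≤ y → Supported A t

  sameBlock⇒inBlock : SameBlock n A x y → InBlock x y
  sameBlock⇒inBlock ((1≤x , _) , (_ , y≤n) , _ , _ , no-free-between) t x≤t t≤y with supported? A t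
  ... | yes t-supp  = t-supp
  ... | no t-unsupp =
    contradiction (inj₁ (x≤t , t≤y)) (no-free-between t ((≤-trans 1≤x x≤t , ≤-trans t≤y y≤n) , t-unsupp))

  -- The partner v of x + 1 is either outside [x, y], and then its arc crosses
  -- the arc at x, or inside, and then it spans a shorter arc in the block.
  arc-in-block⇒adjacent : suc x < y → norm x y ∈ A → InBlock x y → AdjacentCrossing A
  arc-in-block⇒adjacent {x} {y} = go y (m≤m+n y x)
    where
    go : ∀ fuel {x w} → w ≤ fuel + x → suc x < w → norm x w ∈ A → InBlock x w → AdjacentCrossing A
    go zero {x} w≤x 1+x<w _ _ = contradiction w≤x (<⇒≱ (<-trans (n<1+n x) 1+x<w))
    go (suc fuel) {x} {w} w≤ 1+x<w xw∈A block
      with v , v∈A ← chord-at (block (suc x) (n≤1+n x) (<⇒≤ 1+x<w))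
      with ArcEnds-far (ends v∈A)
    ... | inj₁ 1+v<1+x = adjacent-at xw∈A v∈A
      (subst₂ Cross (sym (norm-< x<w)) (sym (norm-> (m<n⇒m<1+n v<x))) (inj₂ (v<x , n<1+n x , 1+x<w)))
      where
      v<x = ≤-pred 1+v<1+x
      x<w = <-trans (n<1+n x) 1+x<w
    ... | inj₂ 2+x<v with <-cmp v w
    ...   | tri< v<w _ _ = go fuel (≤-trans (≤-pred (<-≤-trans v<w w≤)) (+-monoʳ-≤ fuel (n≤1+n x))) 2+x<v v∈A
                              (λ t 1+x≤t t≤v → block t (≤-trans (n≤1+n x) 1+x≤t) (≤-trans t≤v (<⇒≤ v<w)))
    ...   | tri≈ _ refl _ = contradiction (sym (partner-unique (norm∈-comm xw∈A) (norm∈-comm v∈A))) 1+n≢n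
    ...   | tri> _ _ w<v = adjacent-at xw∈A v∈A
      (subst₂ Cross (sym (norm-< (<-trans (n<1+n x) 1+x<w))) (sym (norm-< (<-trans (n<1+n (suc x)) 2+x<v)))
        (inj₁ (n<1+n x , 1+x<w , w<v)))

  partner-outside : InBlock x y → x ≤ i → i ≤ y → norm i o ∈ A → AdjacentCrossing A ⊎ Outside x y o
  partner-outside {x} {y} {i} {o} block x≤i i≤y io∈A with o <? x | y <? o
  ... | yes o<x | _       = inj₂ (inj₁ o<x)
  ... | no _    | yes y<o = inj₂ (inj₂ y<o)
  ... | no o≮x  | no y≮o with ArcEnds-far (ends io∈A)
  ...   | inj₁ 1+o<i = inj₁ (arc-in-block⇒adjacent 1+o<i (norm∈-comm io∈A)
                          (λ t o≤t t≤i → block t (≤-trans (≮⇒≥ o≮x) o≤t) (≤-trans t≤i i≤y)))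
  ...   | inj₂ 1+i<o = inj₁ (arc-in-block⇒adjacent 1+i<o io∈A
                          (λ t i≤t t≤o → block t (≤-trans x≤i i≤t) (≤-trans t≤o (≮⇒≥ y≮o))))

  -- Unless it spans an arc inside the block, the arc at x + 1 crosses the arc
  -- at x or the arc at y; in the latter case we move on from x + 1.
  crossing-in-block⇒adjacent : x < y → norm x p ∈ A → norm y q ∈ A → Cross (norm x p) (norm y q) →
    InBlock x y → AdjacentCrossing A
  crossing-in-block⇒adjacent {x} {y} = go y (m≤m+n y x)
    where
    go : ∀ fuel {x y p q} → y ≤ fuel + x → x < y → norm x p ∈ A → norm y q ∈ A → Cross (norm x p) (norm y q) →
      InBlock x y → AdjacentCrossing A
    go zero y≤x x<y _ _ _ _ = contradiction y≤x (<⇒≱ x<y)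
    go (suc fuel) {x} {y} {p} {q} y≤ x<y xp∈A yq∈A X block with y ≟ suc x
    ... | yes refl = adjacent-at xp∈A yq∈A X
    ... | no y≢1+x
      with partner-outside block ≤-refl (<⇒≤ x<y) xp∈A | partner-outside block (<⇒≤ x<y) ≤-refl yq∈A
    ...   | inj₁ adj | _        = adj
    ...   | inj₂ _   | inj₁ adj = adj
    ...   | inj₂ p-out | inj₂ q-out
      with v , v∈A ← chord-at (block (suc x) (n≤1+n x) x<y)
      with partner-outside block (n≤1+n x) x<y v∈A
    ...     | inj₁ adj = adj
    ...     | inj₂ v-out
      with outerCross-split v-out v≢p (cross⇒outerCross ≤-refl x<y ≤-refl p-out q-out X)
      where
      v≢p : v ≢ p
      v≢p refl = 1+n≢n (sym (partner-unique (norm∈-comm xp∈A) (norm∈-comm v∈A)))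
    ...       | inj₁ pv = adjacent-at xp∈A v∈A (outerCross⇒cross ≤-refl (n<1+n x) x<y pv)
    ...       | inj₂ vq = go fuel (subst (y ≤_) (sym (+-suc fuel x)) y≤) 1+x<y v∈A yq∈A
                            (outerCross⇒cross (n≤1+n x) 1+x<y ≤-refl vq)
                            (λ t 1+x≤t t≤y → block t (≤-trans (n≤1+n x) 1+x≤t) t≤y)
      where
      1+x<y = ≤∧≢⇒< x<y (≢-sym y≢1+x)

SameBlock-sym : ∀ {A} → SameBlock n A x y → SameBlock n A y x
SameBlock-sym (x-site , y-site , x-nonfree , y-nonfree , no-free-between) =
  y-site , x-site , y-nonfree , x-nonfree , λ u u-free → no-free-between u u-free ∘ swap

¬adjacent⇒regular : ∀ {A} → IsDiagram n A → Binary A → ¬ AdjacentCrossing A → Regular n A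
¬adjacent⇒regular {n} {A} diagram binary ¬adj = diagram , binary , not-in-block
  where
  open Blocks diagram binary
  not-in-block : ∀ e e′ x y → e ∈ A → e′ ∈ A → Cross e e′ → Supports e x → Supports e′ y → ¬ SameBlock n A x y
  not-in-block e e′ x y e∈A e′∈A X e∋x e′∋y same
    with p , refl ← partner (valid e∈A) e∋x
    with q , refl ← partner (valid e′∈A) e′∋y
    with <-cmp x y
  ... | tri< x<y _ _  = ¬adj (crossing-in-block⇒adjacent x<y e∈A e′∈A X (sameBlock⇒inBlock same))
  ... | tri≈ _ refl _ = Cross-irrefl (subst (Cross e) (sym (proj₂ binary _ _ x e∈A e′∈A e∋x e′∋y)) X)
  ... | tri> _ _ y<x  =
    ¬adj (crossing-in-block⇒adjacent y<x e′∈A e∈A (Cross-sym X) (sameBlock⇒inBlock (SameBlock-sym same)))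

-- Iterating swaps

swap-step : ∀ {A} → Proper n A → AdjacentCrossing A →
  ∃[ B ] (StrictSwap n A B × Equivalent n A B × (∀ {u} → Free n A u → Free n B u))
swap-step proper (e , e′ , e∈A , e′∈A , X , s , e∋s , e′∋1+s)
  with r₁ , refl ← partner (All.lookup (proj₁ (proj₁ proper)) e∈A) e∋s
  with r₂ , refl ← partner (All.lookup (proj₁ (proj₁ proper)) e′∈A) e′∋1+s
  = B , strictSwap , equivalent , free⇒free
  where open Uncross proper e∈A e′∈A X

Equivalent-refl : ∀ {A} → Proper n A → Equivalent n A A
Equivalent-refl proper = proper , proper , ⤖-id _ , λ _ _ _ → ⇔-id _

Equivalent-trans : ∀ {A B C} → Equivalent n A B → (∀ {u} → Free n A u → Free n B u) → Equivalent n B C →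
  Equivalent n A C
Equivalent-trans (proper-A , _ , φ , φ-cover) free⇒free (_ , proper-C , ψ , ψ-cover) =
  proper-A , proper-C , ψ ⤖-∘ φ ,
  λ i u u-free → ψ-cover (Bijection.to φ i) u (free⇒free u-free) ⇔-∘ φ-cover i u u-free

Uncrossing : ℕ → List Arc → Set
Uncrossing n A = ∃[ S′ ] (StrictSwaps n A S′ × Regular n S′ × Equivalent n A S′ × (∀ {u} → Free n A u → Free n S′ u))

uncross : ∀ k {A} → crossings A ≡ k → Proper n A → Uncrossing n A
uncross k {A} count proper with adjacentCrossing? A
... | no ¬adj = A , done , ¬adjacent⇒regular (proj₁ proper) (proj₁ (proj₂ proper)) ¬adj , Equivalent-refl proper , id
... | yes adj with B , swap@(_ , fewer) , equiv@(_ , proper-B , _) , free⇒free ← swap-step proper adj with k | count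
...   | zero   | count = contradiction (trans fewer count) λ ()
...   | suc k′ | count
  with S′ , swaps , regular , equiv′ , free⇒free′ ← uncross k′ (suc-injective (trans fewer count)) proper-B
  = S′ , step swap swaps , regular , Equivalent-trans equiv free⇒free equiv′ , free⇒free′ ∘ free⇒free

proposition6p2 : (n : ℕ) (S : List Arc) → Proper n S →
    ∃[ S' ] (StrictSwaps n S S' × Regular n S' × Equivalent n S S')
proposition6p2 n S proper with S′ , swaps , regular , equivalent , _ ← uncross (crossings S) refl proper =
  S′ , swaps , regular , equivalent
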